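{- Let $k\ge 1$ be an integer, $N=2^k-1$, and $n=N+j$ where $j$ is an integer with $1\le j\le 2^k$. Let $c=2^{N-k}$ (the number of codewords of the binary Hamming code of length $N$). Then $\gamma_c(Q_n)\le 2^j c+2(c-1)$.
   Context: The $n$-cube $Q_n$ has as vertices the $2^n$ binary strings of length $n$, two being adjacent iff they differ in exactly one coordinate. A connected dominating set is a vertex set $W$ such that every vertex is in $W$ or adjacent to a vertex of $W$, and the subgraph induced by $W$ is connected. $\gamma_c(G)$ denotes the minimum size of a connected dominating set of $G$. -}

module Defs where

open import Data.Nat using (ℕ; zero; suc; _+_)
open import Data.Bool using (Bool; true; false; _xor_)
open import Data.Vec using (Vec; []; _∷_)
open import Data.List using (List; []; _∷_; length)
open import Data.List.Relation.Unary.All using (All)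
open import Data.List.Relation.Unary.Any using (Any)
open import Data.List.Relation.Unary.Unique.Propositional using (Unique)
open import Data.List.Membership.Propositional using (_∈_)
open import Data.Sum using (_⊎_)
open import Data.Product using (Σ; _×_)
open import Relation.Binary.PropositionalEquality using (_≡_)

Vertex : ℕ → Set
Vertex n = Vec Bool n

hamming : ∀ {n} → Vertex n → Vertex n → ℕ
hamming [] [] = 0
hamming (x ∷ xs) (y ∷ ys) with x xor y
... | true  = suc (hamming xs ys)
... | false = hamming xs ys

Adj : ∀ {n} → Vertex n → Vertex n → Set
Adj u v = hamming u v ≡ 1

data Walk {n : ℕ} : Vertex n → Vertex n → List (Vertex n) → Set where
  -- the list records all vertices visited by the walk
  here  : ∀ {u} → Walk u u (u ∷ [])
  step  : ∀ {u w v ws} → Adj u w → Walk w v ws → Walk u v (u ∷ ws)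

-- Finite vertex set W represented by a duplicate-free list; |W| = length.
-- W is dominating: every vertex is in W or adjacent to a vertex of W.
Dominating : ∀ {n} → List (Vertex n) → Set
Dominating {n} W = (v : Vertex n) → Any (λ w → v ≡ w ⊎ Adj v w) W

InducedConnected : ∀ {n} → List (Vertex n) → Set
InducedConnected {n} W =
  ∀ {u v : Vertex n} → u ∈ W → v ∈ W →
    Σ (List (Vertex n)) (λ ws → Walk u v ws × All (_∈ W) ws)

record ConnectedDominatingSet (n : ℕ) : Set where
  field
    elems     : List (Vertex n)
    unique    : Unique elems
    dominating : Dominating elems
    connected : InducedConnected elems

  size : ℕ
  size = length elems

module Submission where

-- The construction follows the recursive description of the binary Hamming
-- codes.  A *connected code* of length N and dimension M is a list C of 2^M
-- words of Q_N such that every vertex is at distance at most 1 from C,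
-- together with a list P of connectors, |P| ≤ 2|C| - 2, such that C ∪ P
-- induces a connected subgraph (every member is joined to a common root).
--
-- 1. Algebra of words: bitwise xor, Hamming distance, parity, and the
--    operation clearing the leading one (which walks every word to zero).
-- 2. Walks inside a vertex list and how to compose, reverse and map them.
-- 3. The doubling step: from a connected code (N, M) the codewords
--    (par u, u, u ⊕ v), u ∈ Q_N, v ∈ C, form a connected code (2N+1, N+M);
--    each codeword with u ≠ 0 is joined to the one for u with its leading
--    one cleared by a path of length 3 through two new connectors.
-- 4. Iterating k times from the length-0 code gives N = 2^k - 1, M = N - k.
-- 5. For any j, C × Q_j together with P × {0} is a connected dominating set
--    of Q_{N+j} with at most 2^j·2^M + 2(2^M - 1) vertices: this is
--    Proposition 5.

open import Defs
open import Data.Nat using (ℕ; zero; suc; _+_; _*_; _∸_; _^_; _≤_; z≤n; s≤s)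
open import Data.Nat.Properties
open import Data.Nat.Solver using (module +-*-Solver)
open import Data.Bool using (Bool; true; false; _xor_; not)
open import Data.Bool.Properties using (xor-comm; ¬-not; not-involutive) renaming (_≟_ to _≟B_)
open import Data.Vec using ([]; _∷_; _++_; splitAt; replicate; zipWith)
open import Data.Vec.Properties using (≡-dec; zipWith-comm)
open import Data.List using (List; []; _∷_; length; map; cartesianProductWith; deduplicate)
  renaming (_++_ to _++ₗ_)
open import Data.List.Properties using (length-++; length-map; length-deduplicate)
open import Data.List.Relation.Unary.All using (All; []; _∷_)
open import Data.List.Relation.Unary.Any using (here; there)
open import Data.List.Membership.Propositional using (_∈_; lose)
open import Data.List.Membership.Propositional.Properties
  using (∈-map⁺; ∈-map⁻; ∈-++⁺ˡ; ∈-++⁺ʳ; ∈-++⁻; ∈-cartesianProductWith⁺;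
         ∈-cartesianProductWith⁻; ∈-deduplicate⁺; ∈-deduplicate⁻)
open import Data.List.Relation.Unary.Unique.DecPropositional.Properties using (deduplicate-!)
open import Data.Product using (Σ; _×_; _,_)
open import Data.Sum using (_⊎_; inj₁; inj₂; map₁)
open import Relation.Nullary using (Dec; yes; no)
open import Relation.Binary.PropositionalEquality

open +-*-Solver using (solve; _:+_; _:*_; _:=_; con)

zeros : ∀ {n} → Vertex n
zeros = replicate _ false

infixl 6 _⊕_
_⊕_ : ∀ {n} → Vertex n → Vertex n → Vertex n
_⊕_ = zipWith _xor_

⊕-comm : ∀ {n} (x y : Vertex n) → x ⊕ y ≡ y ⊕ x
⊕-comm = zipWith-comm xor-comm

⊕-cancelˡ : ∀ {n} (x y : Vertex n) → x ⊕ (x ⊕ y) ≡ y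
⊕-cancelˡ [] [] = refl
⊕-cancelˡ (true ∷ x) (true ∷ y) = cong (true ∷_) (⊕-cancelˡ x y)
⊕-cancelˡ (true ∷ x) (false ∷ y) = cong (false ∷_) (⊕-cancelˡ x y)
⊕-cancelˡ (false ∷ x) (true ∷ y) = cong (true ∷_) (⊕-cancelˡ x y)
⊕-cancelˡ (false ∷ x) (false ∷ y) = cong (false ∷_) (⊕-cancelˡ x y)

⊕-cancelʳ : ∀ {n} (x y : Vertex n) → (x ⊕ y) ⊕ y ≡ x
⊕-cancelʳ x y = trans (⊕-comm (x ⊕ y) y) (trans (cong (y ⊕_) (⊕-comm x y)) (⊕-cancelˡ y x))

ham-refl : ∀ {n} (x : Vertex n) → hamming x x ≡ 0
ham-refl [] = refl
ham-refl (true ∷ x) = ham-refl x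
ham-refl (false ∷ x) = ham-refl x

ham-sym : ∀ {n} (x y : Vertex n) → hamming x y ≡ hamming y x
ham-sym [] [] = refl
ham-sym (true ∷ x) (true ∷ y) = ham-sym x y
ham-sym (true ∷ x) (false ∷ y) = cong suc (ham-sym x y)
ham-sym (false ∷ x) (true ∷ y) = cong suc (ham-sym x y)
ham-sym (false ∷ x) (false ∷ y) = ham-sym x y

ham-≡0 : ∀ {n} (x y : Vertex n) → hamming x y ≡ 0 → x ≡ y
ham-≡0 [] [] _ = refl
ham-≡0 (true ∷ x) (true ∷ y) e = cong (true ∷_) (ham-≡0 x y e)
ham-≡0 (false ∷ x) (false ∷ y) e = cong (false ∷_) (ham-≡0 x y e)

ham-flip : ∀ a → hamming (a ∷ []) (not a ∷ []) ≡ 1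
ham-flip true = refl
ham-flip false = refl

ham-++ : ∀ {m n} (x x' : Vertex m) (y y' : Vertex n) →
  hamming (x ++ y) (x' ++ y') ≡ hamming x x' + hamming y y'
ham-++ [] [] y y' = refl
ham-++ (true ∷ x) (true ∷ x') y y' = ham-++ x x' y y'
ham-++ (true ∷ x) (false ∷ x') y y' = cong suc (ham-++ x x' y y')
ham-++ (false ∷ x) (true ∷ x') y y' = cong suc (ham-++ x x' y y')
ham-++ (false ∷ x) (false ∷ x') y y' = ham-++ x x' y y'

ham-prefix : ∀ {m n} (x : Vertex m) (y y' : Vertex n) → hamming (x ++ y) (x ++ y') ≡ hamming y y'
ham-prefix x y y' = trans (ham-++ x x y y') (cong (_+ hamming y y') (ham-refl x))

ham-suffix : ∀ {m n} (x x' : Vertex m) (y : Vertex n) → hamming (x ++ y) (x' ++ y) ≡ hamming x x'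
ham-suffix x x' y = trans (ham-++ x x' y y) (trans (cong (hamming x x' +_) (ham-refl y)) (+-identityʳ _))

ham-⊕ˡ : ∀ {n} (c a b : Vertex n) → hamming (c ⊕ a) (c ⊕ b) ≡ hamming a b
ham-⊕ˡ [] [] [] = refl
ham-⊕ˡ (true ∷ c) (true ∷ a) (true ∷ b) = ham-⊕ˡ c a b
ham-⊕ˡ (true ∷ c) (true ∷ a) (false ∷ b) = cong suc (ham-⊕ˡ c a b)
ham-⊕ˡ (true ∷ c) (false ∷ a) (true ∷ b) = cong suc (ham-⊕ˡ c a b)
ham-⊕ˡ (true ∷ c) (false ∷ a) (false ∷ b) = ham-⊕ˡ c a b
ham-⊕ˡ (false ∷ c) (true ∷ a) (true ∷ b) = ham-⊕ˡ c a b
ham-⊕ˡ (false ∷ c) (true ∷ a) (false ∷ b) = cong suc (ham-⊕ˡ c a b)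
ham-⊕ˡ (false ∷ c) (false ∷ a) (true ∷ b) = cong suc (ham-⊕ˡ c a b)
ham-⊕ˡ (false ∷ c) (false ∷ a) (false ∷ b) = ham-⊕ˡ c a b

ham-⊕ʳ : ∀ {n} (a b c : Vertex n) → hamming (a ⊕ c) (b ⊕ c) ≡ hamming a b
ham-⊕ʳ a b c rewrite ⊕-comm a c | ⊕-comm b c = ham-⊕ˡ c a b

ham-shift : ∀ {n} (x y z : Vertex n) → hamming x (y ⊕ z) ≡ hamming (y ⊕ x) z
ham-shift x y z = trans (sym (ham-⊕ˡ y x (y ⊕ z))) (cong (hamming (y ⊕ x)) (⊕-cancelˡ y z))

adj-sym : ∀ {n} {x y : Vertex n} → Adj x y → Adj y x
adj-sym {x = x} {y} a = trans (ham-sym y x) a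

≤1⇒≡0⊎≡1 : ∀ {m} → m ≤ 1 → m ≡ 0 ⊎ m ≡ 1
≤1⇒≡0⊎≡1 z≤n = inj₁ refl
≤1⇒≡0⊎≡1 (s≤s z≤n) = inj₂ refl

near : ∀ {n} (x y : Vertex n) → hamming x y ≤ 1 → x ≡ y ⊎ Adj x y
near x y d = map₁ (ham-≡0 x y) (≤1⇒≡0⊎≡1 d)

par : ∀ {n} → Vertex n → Bool
par [] = false
par (a ∷ x) = a xor par x

par-adj : ∀ {n} (x y : Vertex n) → Adj x y → par y ≡ not (par x)
par-adj [] [] ()
par-adj (true ∷ x) (true ∷ y) e = cong not (par-adj x y e)
par-adj (false ∷ x) (false ∷ y) e = par-adj x y e
par-adj (true ∷ x) (false ∷ y) e rewrite ham-≡0 x y (suc-injective e) = sym (not-involutive (par y))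
par-adj (false ∷ x) (true ∷ y) e rewrite ham-≡0 x y (suc-injective e) = refl

weight : ∀ {n} → Vertex n → ℕ
weight [] = 0
weight (true ∷ x) = suc (weight x)
weight (false ∷ x) = weight x

clr : ∀ {n} → Vertex n → Vertex n
clr [] = []
clr (true ∷ x) = false ∷ x
clr (false ∷ x) = false ∷ clr x

weight≡0 : ∀ {n} (x : Vertex n) → weight x ≡ 0 → x ≡ zeros
weight≡0 [] _ = refl
weight≡0 (false ∷ x) e = cong (false ∷_) (weight≡0 x e)

weight-clr : ∀ {n m} (x : Vertex n) → weight x ≡ suc m → weight (clr x) ≡ m
weight-clr (true ∷ x) e = suc-injective e
weight-clr (false ∷ x) e = weight-clr x e

adj-clr : ∀ {n m} (x : Vertex n) → weight x ≡ suc m → Adj x (clr x)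
adj-clr (true ∷ x) _ = cong suc (ham-refl x)
adj-clr (false ∷ x) e = adj-clr x e

allWords : ∀ n → List (Vertex n)
allWords zero = [] ∷ []
allWords (suc n) = map (true ∷_) (allWords n) ++ₗ map (false ∷_) (allWords n)

∈-allWords : ∀ {n} (x : Vertex n) → x ∈ allWords n
∈-allWords [] = here refl
∈-allWords (true ∷ x) = ∈-++⁺ˡ (∈-map⁺ (true ∷_) (∈-allWords x))
∈-allWords {suc n} (false ∷ x) = ∈-++⁺ʳ (map (true ∷_) (allWords n)) (∈-map⁺ (false ∷_) (∈-allWords x))

length-blocks : ∀ {n} {A : Set} (xs ys : List (Vertex n)) (f g : Vertex n → A) →
  length (map f xs ++ₗ map g ys) ≡ length xs + length ys
length-blocks xs ys f g = trans (length-++ (map f xs)) (cong₂ _+_ (length-map f xs) (length-map g ys))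

length-allWords : ∀ n → length (allWords n) ≡ 2 ^ n
length-allWords zero = refl
length-allWords (suc n) = begin
  length (allWords (suc n))                    ≡⟨ length-blocks (allWords n) (allWords n) _ _ ⟩
  length (allWords n) + length (allWords n)    ≡⟨ cong₂ _+_ (length-allWords n) (length-allWords n) ⟩
  2 ^ n + 2 ^ n                                ≡⟨ cong (2 ^ n +_) (sym (+-identityʳ (2 ^ n))) ⟩
  2 ^ suc n                                    ∎
  where open ≡-Reasoning

nonzeroWords : ∀ n → List (Vertex n)
nonzeroWords zero = []
nonzeroWords (suc n) = map (true ∷_) (allWords n) ++ₗ map (false ∷_) (nonzeroWords n)

∈-nonzeroWords : ∀ {n m} (x : Vertex n) → weight x ≡ suc m → x ∈ nonzeroWords n
∈-nonzeroWords (true ∷ x) _ = ∈-++⁺ˡ (∈-map⁺ (true ∷_) (∈-allWords x))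
∈-nonzeroWords {suc n} (false ∷ x) e =
  ∈-++⁺ʳ (map (true ∷_) (allWords n)) (∈-map⁺ (false ∷_) (∈-nonzeroWords x e))

nonzeroWords-weight : ∀ {n} {x : Vertex n} → x ∈ nonzeroWords n → Σ ℕ (λ m → weight x ≡ suc m)
nonzeroWords-weight {suc n} x∈ with ∈-++⁻ (map (true ∷_) (allWords n)) x∈
... | inj₁ x∈₁ with ∈-map⁻ (true ∷_) x∈₁
...   | y , _ , refl = weight y , refl
nonzeroWords-weight {suc n} x∈ | inj₂ x∈₂ with ∈-map⁻ (false ∷_) x∈₂
...   | y , y∈ , refl = nonzeroWords-weight y∈

length-nonzeroWords : ∀ n → length (nonzeroWords n) + 1 ≡ 2 ^ n
length-nonzeroWords zero = refl
length-nonzeroWords (suc n) = begin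
  length (nonzeroWords (suc n)) + 1
    ≡⟨ cong (_+ 1) (length-blocks (allWords n) (nonzeroWords n) _ _) ⟩
  length (allWords n) + length (nonzeroWords n) + 1
    ≡⟨ +-assoc (length (allWords n)) _ 1 ⟩
  length (allWords n) + (length (nonzeroWords n) + 1)
    ≡⟨ cong₂ _+_ (length-allWords n) (trans (length-nonzeroWords n) (sym (+-identityʳ (2 ^ n)))) ⟩
  2 ^ suc n ∎
  where open ≡-Reasoning

length-cartesianProductWith : ∀ {A B C : Set} (f : A → B → C) (xs : List A) (ys : List B) →
  length (cartesianProductWith f xs ys) ≡ length xs * length ys
length-cartesianProductWith f [] ys = refl
length-cartesianProductWith f (x ∷ xs) ys = trans (length-++ (map (f x) ys))
  (cong₂ _+_ (length-map (f x) ys) (length-cartesianProductWith f xs ys))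

data Path {n : ℕ} (W : List (Vertex n)) : Vertex n → Vertex n → Set where
  nil  : ∀ {u} → u ∈ W → Path W u u
  cons : ∀ {u w v} → u ∈ W → Adj u w → Path W w v → Path W u v

_▸_ : ∀ {n} {W : List (Vertex n)} {u v w} → Path W u v → Path W v w → Path W u w
nil _ ▸ q = q
cons u∈ a p ▸ q = cons u∈ a (p ▸ q)
infixr 5 _▸_

start∈ : ∀ {n} {W : List (Vertex n)} {u v} → Path W u v → u ∈ W
start∈ (nil u∈) = u∈
start∈ (cons u∈ _ _) = u∈

reverse : ∀ {n} {W : List (Vertex n)} {u v} → Path W u v → Path W v u
reverse (nil u∈) = nil u∈
reverse (cons {u = u} {w = w} u∈ a p) = reverse p ▸ cons (start∈ p) (adj-sym {x = u} {y = w} a) (nil u∈)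

map-path : ∀ {n m} {W : List (Vertex n)} {W' : List (Vertex m)} (f : Vertex n → Vertex m) →
  (∀ {x} → x ∈ W → f x ∈ W') → (∀ {x y} → Adj x y → Adj (f x) (f y)) →
  ∀ {u v} → Path W u v → Path W' (f u) (f v)
map-path f mem adj (nil u∈) = nil (mem u∈)
map-path f mem adj (cons u∈ a p) = cons (mem u∈) (adj a) (map-path f mem adj p)

weaken : ∀ {n} {W W' : List (Vertex n)} → (∀ {x} → x ∈ W → x ∈ W') →
  ∀ {u v} → Path W u v → Path W' u v
weaken sub = map-path (λ x → x) sub (λ a → a)

toWalk : ∀ {n} {W : List (Vertex n)} {u v} → Path W u v →
  Σ (List (Vertex n)) (λ ws → Walk u v ws × All (_∈ W) ws)
toWalk (nil u∈) = _ , here , u∈ ∷ []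
toWalk (cons u∈ a p) with toWalk p
... | ws , walk , all = _ , step a walk , u∈ ∷ all

descend : ∀ {n m} (W : List (Vertex m)) (g : Vertex n → Vertex m) → g zeros ∈ W →
  (∀ {k} (u : Vertex n) → weight u ≡ suc k → Path W (g u) (g (clr u))) →
  ∀ u → Path W (g u) (g zeros)
descend {n} W g zero∈ clear-step u = go (weight u) u refl
  where
  go : ∀ k (u : Vertex n) → weight u ≡ k → Path W (g u) (g zeros)
  go zero u e = subst (λ x → Path W (g x) (g zeros)) (sym (weight≡0 u e)) (nil zero∈)
  go (suc k) u e = clear-step u e ▸ go k (clr u) (weight-clr u e)

Covers : ∀ {n} → List (Vertex n) → Set
Covers {n} C = ∀ x → Σ (Vertex n) λ h → h ∈ C × hamming x h ≤ 1

record ConnectedCode (N M : ℕ) : Set where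
  field
    code            : List (Vertex N)
    connectors      : List (Vertex N)
    root            : Vertex N
    covering        : Covers code
    reaches-root    : ∀ {x} → x ∈ code ++ₗ connectors → Path (code ++ₗ connectors) x root
    size-code       : length code ≡ 2 ^ M
    size-connectors : length connectors + 2 ≤ 2 * length code

trivialCode : ConnectedCode 0 0
trivialCode = record
  { code = [] ∷ [] ; connectors = [] ; root = []
  ; covering = λ { [] → [] , here refl , z≤n }
  ; reaches-root = λ { (here refl) → nil (here refl) ; (there ()) }
  ; size-code = refl ; size-connectors = ≤-refl }

module Doubling {N M : ℕ} (L : ConnectedCode N M) where
  open ConnectedCode L

  enc : Vertex N → Vertex N → Vertex (suc (N + N))
  enc u v = par u ∷ (u ++ (u ⊕ v))

  -- The two connectors on the path enc u v — via₁ — via₂ — enc (clr u) v: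
  -- first clear the leading one of u in the middle block, then in the last
  -- block, and finally flip the parity bit.
  via₁ via₂ : Vertex N → Vertex N → Vertex (suc (N + N))
  via₁ u v = par u ∷ (clr u ++ (u ⊕ v))
  via₂ u v = par u ∷ (clr u ++ (clr u ⊕ v))

  code' upper lower lifted connectors' W' : List (Vertex (suc (N + N)))
  code' = cartesianProductWith enc (allWords N) code
  upper = cartesianProductWith via₁ (nonzeroWords N) code
  lower = cartesianProductWith via₂ (nonzeroWords N) code
  lifted = map (enc zeros) connectors
  connectors' = upper ++ₗ (lower ++ₗ lifted)
  W' = code' ++ₗ connectors'

  root' : Vertex (suc (N + N))
  root' = enc zeros root

  ∈code' : ∀ u {v} → v ∈ code → enc u v ∈ code'
  ∈code' u v∈ = ∈-cartesianProductWith⁺ enc (∈-allWords u) v∈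

  ∈W'-code : ∀ u {v} → v ∈ code → enc u v ∈ W'
  ∈W'-code u v∈ = ∈-++⁺ˡ (∈code' u v∈)

  ∈W'-upper : ∀ {u v} → u ∈ nonzeroWords N → v ∈ code → via₁ u v ∈ W'
  ∈W'-upper u∈ v∈ = ∈-++⁺ʳ code' (∈-++⁺ˡ (∈-cartesianProductWith⁺ via₁ u∈ v∈))

  ∈W'-lower : ∀ {u v} → u ∈ nonzeroWords N → v ∈ code → via₂ u v ∈ W'
  ∈W'-lower u∈ v∈ = ∈-++⁺ʳ code' (∈-++⁺ʳ upper (∈-++⁺ˡ (∈-cartesianProductWith⁺ via₂ u∈ v∈)))

  ∈W'-lifted : ∀ {x} → x ∈ code ++ₗ connectors → enc zeros x ∈ W'
  ∈W'-lifted x∈ with ∈-++⁻ code x∈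
  ... | inj₁ x∈code = ∈W'-code zeros x∈code
  ... | inj₂ x∈conn = ∈-++⁺ʳ code' (∈-++⁺ʳ upper (∈-++⁺ʳ lower (∈-map⁺ (enc zeros) x∈conn)))

  enc-via₁ : ∀ {k} u v → weight u ≡ suc k → Adj (enc u v) (via₁ u v)
  enc-via₁ u v e = trans (ham-prefix (par u ∷ []) _ _) (trans (ham-suffix u (clr u) (u ⊕ v)) (adj-clr u e))

  via₁-via₂ : ∀ {k} u v → weight u ≡ suc k → Adj (via₁ u v) (via₂ u v)
  via₁-via₂ u v e = trans (ham-prefix (par u ∷ clr u) _ _) (trans (ham-⊕ʳ u (clr u) v) (adj-clr u e))

  via₂-enc : ∀ {k} u v → weight u ≡ suc k → Adj (via₂ u v) (enc (clr u) v)
  via₂-enc u v e = begin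
    hamming (via₂ u v) (enc (clr u) v)          ≡⟨ ham-suffix (par u ∷ []) (par (clr u) ∷ []) _ ⟩
    hamming (par u ∷ []) (par (clr u) ∷ [])     ≡⟨ cong (λ b → hamming (par u ∷ []) (b ∷ [])) (par-adj u (clr u) (adj-clr u e)) ⟩
    hamming (par u ∷ []) (not (par u) ∷ [])     ≡⟨ ham-flip (par u) ⟩
    1                                           ∎
    where open ≡-Reasoning

  lift : ∀ {x y} → Path (code ++ₗ connectors) x y → Path W' (enc zeros x) (enc zeros y)
  lift = map-path (enc zeros) ∈W'-lifted λ {x} {y} a →
    trans (ham-prefix (par (zeros {N}) ∷ zeros {N}) (zeros ⊕ x) (zeros ⊕ y)) (trans (ham-⊕ˡ zeros x y) a)

  codeword-to-root : ∀ {v} → v ∈ code → ∀ u → Path W' (enc u v) root'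
  codeword-to-root {v} v∈ u =
    descend W' (λ u → enc u v) (∈W'-code zeros v∈) clear-step u
    ▸ lift (reaches-root (∈-++⁺ˡ v∈))
    where
    clear-step : ∀ {k} u → weight u ≡ suc k → Path W' (enc u v) (enc (clr u) v)
    clear-step u e = let u∈ = ∈-nonzeroWords u e in
      cons (∈W'-code u v∈) (enc-via₁ u v e) (cons (∈W'-upper u∈ v∈) (via₁-via₂ u v e)
        (cons (∈W'-lower u∈ v∈) (via₂-enc u v e) (nil (∈W'-code (clr u) v∈))))

  reaches-root' : ∀ {x} → x ∈ W' → Path W' x root'
  reaches-root' x∈ with ∈-++⁻ code' x∈
  ... | inj₁ x∈₁ with ∈-cartesianProductWith⁻ enc (allWords N) code x∈₁
  ...   | u , v , _ , v∈ , refl = codeword-to-root v∈ u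
  reaches-root' x∈ | inj₂ x∈₂ with ∈-++⁻ upper x∈₂
  ... | inj₁ x∈₃ with ∈-cartesianProductWith⁻ via₁ (nonzeroWords N) code x∈₃
  ...   | u , v , u∈ , v∈ , refl with nonzeroWords-weight u∈
  ...     | _ , e = cons (∈W'-upper u∈ v∈) (adj-sym {x = enc u v} (enc-via₁ u v e)) (codeword-to-root v∈ u)
  reaches-root' x∈ | inj₂ x∈₂ | inj₂ x∈₄ with ∈-++⁻ lower x∈₄
  ... | inj₁ x∈₅ with ∈-cartesianProductWith⁻ via₂ (nonzeroWords N) code x∈₅
  ...   | u , v , u∈ , v∈ , refl with nonzeroWords-weight u∈
  ...     | _ , e = cons (∈W'-lower u∈ v∈) (via₂-enc u v e) (codeword-to-root v∈ (clr u))
  reaches-root' x∈ | inj₂ x∈₂ | inj₂ x∈₄ | inj₂ x∈₆ with ∈-map⁻ (enc zeros) x∈₆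
  ... | p , p∈ , refl = lift (reaches-root (∈-++⁺ʳ code p∈))

  -- Covering: for (b, x₁, x₂) pick h ∈ code near s = x₁ ⊕ x₂.  If b = par x₁
  -- or s = h, the codeword enc x₁ h works; otherwise enc (x₂ ⊕ h) h does.
  distance-to-enc : ∀ b (x₁ x₂ u h : Vertex N) → hamming (b ∷ x₁ ++ x₂) (enc u h)
    ≡ hamming (b ∷ []) (par u ∷ []) + (hamming x₁ u + hamming x₂ (u ⊕ h))
  distance-to-enc b x₁ x₂ u h =
    trans (ham-++ (b ∷ []) (par u ∷ []) (x₁ ++ x₂) (u ++ (u ⊕ h))) (cong (_ +_) (ham-++ x₁ u x₂ (u ⊕ h)))

  distance-to-enc-x₁ : ∀ b (x₁ x₂ h : Vertex N) →
    hamming (b ∷ x₁ ++ x₂) (enc x₁ h) ≡ hamming (b ∷ []) (par x₁ ∷ []) + hamming (x₁ ⊕ x₂) h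
  distance-to-enc-x₁ b x₁ x₂ h = trans (distance-to-enc b x₁ x₂ x₁ h)
    (cong (hamming (b ∷ []) (par x₁ ∷ []) +_) (cong₂ _+_ (ham-refl x₁) (ham-shift x₂ x₁ h)))

  covering' : Covers code'
  covering' (b ∷ xs) with splitAt N xs
  ... | x₁ , x₂ , refl with covering (x₁ ⊕ x₂)
  ... | h , h∈ , dist≤1 with b ≟B par x₁ | ≤1⇒≡0⊎≡1 dist≤1
  ... | yes refl | _ = enc x₁ h , ∈code' x₁ h∈ ,
        subst (_≤ 1) (sym (trans (distance-to-enc-x₁ b x₁ x₂ h)
                                 (cong (_+ hamming (x₁ ⊕ x₂) h) (ham-refl (b ∷ []))))) dist≤1
  ... | no b≢p | inj₁ dist≡0 = enc x₁ h , ∈code' x₁ h∈ , ≤-reflexive (begin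
        hamming (b ∷ x₁ ++ x₂) (enc x₁ h)                           ≡⟨ distance-to-enc-x₁ b x₁ x₂ h ⟩
        hamming (b ∷ []) (par x₁ ∷ []) + hamming (x₁ ⊕ x₂) h        ≡⟨ cong₂ _+_ bit dist≡0 ⟩
        1                                                           ∎)
    where
    open ≡-Reasoning
    bit : hamming (b ∷ []) (par x₁ ∷ []) ≡ 1
    bit = trans (cong (λ c → hamming (c ∷ []) (par x₁ ∷ [])) (¬-not b≢p))
                (trans (ham-sym (not (par x₁) ∷ []) _) (ham-flip (par x₁)))
  ... | no b≢p | inj₂ dist≡1 = enc u h , ∈code' u h∈ , ≤-reflexive (begin
        hamming (b ∷ x₁ ++ x₂) (enc u h)                                          ≡⟨ distance-to-enc b x₁ x₂ u h ⟩
        hamming (b ∷ []) (par u ∷ []) + (hamming x₁ u + hamming x₂ (u ⊕ h))      ≡⟨ cong₂ _+_ bit (cong₂ _+_ x₁~u u⊕h≡x₂) ⟩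
        1                                                                         ∎)
    where
    open ≡-Reasoning
    u = x₂ ⊕ h
    x₁~u : hamming x₁ u ≡ 1
    x₁~u = trans (ham-shift x₁ x₂ h) (trans (cong (λ y → hamming y h) (⊕-comm x₂ x₁)) dist≡1)
    u⊕h≡x₂ : hamming x₂ (u ⊕ h) ≡ 0
    u⊕h≡x₂ = trans (cong (hamming x₂) (⊕-cancelʳ x₂ h)) (ham-refl x₂)
    bit : hamming (b ∷ []) (par u ∷ []) ≡ 0
    bit = trans (cong (λ c → hamming (b ∷ []) (c ∷ [])) (trans (par-adj x₁ u x₁~u) (sym (¬-not b≢p))))
                (ham-refl (b ∷ []))

  size-code' : length code' ≡ 2 ^ (N + M)
  size-code' = begin
    length code'                 ≡⟨ length-cartesianProductWith enc (allWords N) code ⟩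
    length (allWords N) * length code ≡⟨ cong₂ _*_ (length-allWords N) size-code ⟩
    2 ^ N * 2 ^ M                ≡⟨ sym (^-distribˡ-+-* 2 N M) ⟩
    2 ^ (N + M)                  ∎
    where open ≡-Reasoning

  size-connectors' : length connectors' + 2 ≤ 2 * length code'
  size-connectors' = begin
    length connectors' + 2         ≡⟨ cong (_+ 2) (trans (length-++ upper) (cong₂ _+_
                                        (length-cartesianProductWith via₁ (nonzeroWords N) code)
                                        (trans (length-++ lower) (cong₂ _+_
                                          (length-cartesianProductWith via₂ (nonzeroWords N) code)
                                          (length-map (enc zeros) connectors))))) ⟩
    a * c + (a * c + p) + 2        ≡⟨ regroup a c p ⟩
    2 * (a * c) + (p + 2)          ≤⟨ +-monoʳ-≤ (2 * (a * c)) size-connectors ⟩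
    2 * (a * c) + 2 * c            ≡⟨ factor a c ⟩
    2 * ((a + 1) * c)              ≡⟨ cong (λ z → 2 * (z * c)) (trans (length-nonzeroWords N) (sym (length-allWords N))) ⟩
    2 * (length (allWords N) * c)  ≡⟨ cong (2 *_) (sym (length-cartesianProductWith enc (allWords N) code)) ⟩
    2 * length code'               ∎
    where
    open ≤-Reasoning
    a = length (nonzeroWords N)
    c = length code
    p = length connectors
    regroup : ∀ a c p → a * c + (a * c + p) + 2 ≡ 2 * (a * c) + (p + 2)
    regroup = solve 3 (λ a c p → a :* c :+ (a :* c :+ p) :+ con 2 := con 2 :* (a :* c) :+ (p :+ con 2)) refl
    factor : ∀ a c → 2 * (a * c) + 2 * c ≡ 2 * ((a + 1) * c)
    factor = solve 2 (λ a c → con 2 :* (a :* c) :+ con 2 :* c := con 2 :* ((a :+ con 1) :* c)) refl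

  doubled : ConnectedCode (suc (N + N)) (N + M)
  doubled = record
    { code = code' ; connectors = connectors' ; root = root'
    ; covering = covering' ; reaches-root = reaches-root'
    ; size-code = size-code' ; size-connectors = size-connectors' }

-- Parameters of the k-th Hamming code: length 2^k - 1 and dimension 2^k - 1 - k.
hammingLength : ℕ → ℕ
hammingLength zero = 0
hammingLength (suc k) = suc (hammingLength k + hammingLength k)

hammingDimension : ℕ → ℕ
hammingDimension zero = 0
hammingDimension (suc k) = hammingLength k + hammingDimension k

hammingCode : ∀ k → ConnectedCode (hammingLength k) (hammingDimension k)
hammingCode zero = trivialCode
hammingCode (suc k) = Doubling.doubled (hammingCode k)

hammingLength-+1 : ∀ k → hammingLength k + 1 ≡ 2 ^ k
hammingLength-+1 zero = refl
hammingLength-+1 (suc k) = trans (regroup (hammingLength k))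
  (cong₂ _+_ (hammingLength-+1 k) (trans (hammingLength-+1 k) (sym (+-identityʳ (2 ^ k)))))
  where
  regroup : ∀ n → suc (n + n) + 1 ≡ (n + 1) + (n + 1)
  regroup = solve 1 (λ n → (con 1 :+ (n :+ n)) :+ con 1 := (n :+ con 1) :+ (n :+ con 1)) refl

hammingDimension-+k : ∀ k → hammingDimension k + k ≡ hammingLength k
hammingDimension-+k zero = refl
hammingDimension-+k (suc k) =
  trans (regroup (hammingLength k) (hammingDimension k) k)
        (cong (λ z → suc (hammingLength k + z)) (hammingDimension-+k k))
  where
  regroup : ∀ n m k → (n + m) + suc k ≡ suc (n + (m + k))
  regroup = solve 3 (λ n m k → (n :+ m) :+ (con 1 :+ k) := con 1 :+ (n :+ (m :+ k))) refl

hammingLength-eq : ∀ k → 2 ^ k ∸ 1 ≡ hammingLength k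
hammingLength-eq k = trans (cong (_∸ 1) (sym (hammingLength-+1 k))) (m+n∸n≡m (hammingLength k) 1)

hammingDimension-eq : ∀ k → hammingLength k ∸ k ≡ hammingDimension k
hammingDimension-eq k = trans (cong (_∸ k) (sym (hammingDimension-+k k))) (m+n∸n≡m (hammingDimension k) k)

_≟V_ : ∀ {n} (x y : Vertex n) → Dec (x ≡ y)
_≟V_ = ≡-dec _≟B_

-- Product with a cube: C × Q_j ∪ P × {0} is a connected dominating set of
-- Q_{N+j}.  Each fibre h × Q_j is connected (clear bits of the Q_j part),
-- and P × {0} links the fibres as P links C.
module CubeProduct {N M : ℕ} (j : ℕ) (L : ConnectedCode N M) where
  open ConnectedCode L

  fibres : List (Vertex (N + j))
  fibres = cartesianProductWith _++_ code (allWords j)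

  candidates : List (Vertex (N + j))
  candidates = fibres ++ₗ map (_++ zeros) connectors

  ∈fibres : ∀ {h} → h ∈ code → ∀ y → h ++ y ∈ candidates
  ∈fibres h∈ y = ∈-++⁺ˡ (∈-cartesianProductWith⁺ _++_ h∈ (∈-allWords y))

  ∈candidates-lifted : ∀ {x} → x ∈ code ++ₗ connectors → x ++ zeros ∈ candidates
  ∈candidates-lifted x∈ with ∈-++⁻ code x∈
  ... | inj₁ x∈code = ∈fibres x∈code zeros
  ... | inj₂ x∈conn = ∈-++⁺ʳ fibres (∈-map⁺ (_++ zeros) x∈conn)

  lift : ∀ {x y} → Path (code ++ₗ connectors) x y → Path candidates (x ++ zeros) (y ++ zeros)
  lift = map-path (_++ zeros) ∈candidates-lifted (λ {x} {y} a → trans (ham-suffix x y zeros) a)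

  to-root : ∀ {x} → x ∈ candidates → Path candidates x (root ++ zeros)
  to-root x∈ with ∈-++⁻ fibres x∈
  ... | inj₁ x∈₁ with ∈-cartesianProductWith⁻ _++_ code (allWords j) x∈₁
  ...   | h , y , h∈ , _ , refl =
    descend candidates (h ++_) (∈fibres h∈ zeros)
      (λ u e → cons (∈fibres h∈ u) (trans (ham-prefix h u (clr u)) (adj-clr u e)) (nil (∈fibres h∈ (clr u)))) y
    ▸ lift (reaches-root (∈-++⁺ˡ h∈))
  to-root x∈ | inj₂ x∈₂ with ∈-map⁻ (_++ zeros) x∈₂
  ... | p , p∈ , refl = lift (reaches-root (∈-++⁺ʳ code p∈))

  dominating : Dominating (deduplicate _≟V_ candidates)
  dominating v with splitAt N v
  ... | x , y , refl with covering x
  ... | h , h∈ , x≈h = lose (∈-deduplicate⁺ _≟V_ (∈fibres h∈ y))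
    (near (x ++ y) (h ++ y) (subst (_≤ 1) (sym (ham-suffix x h y)) x≈h))

  cds : ConnectedDominatingSet (N + j)
  cds = record
    { elems = deduplicate _≟V_ candidates
    ; unique = deduplicate-! _≟V_ candidates
    ; dominating = dominating
    ; connected = λ u∈ v∈ → toWalk (weaken (∈-deduplicate⁺ _≟V_)
        (to-root (∈-deduplicate⁻ _≟V_ candidates u∈) ▸ reverse (to-root (∈-deduplicate⁻ _≟V_ candidates v∈))))
    }

  size : ConnectedDominatingSet.size cds ≤ 2 ^ j * 2 ^ M + 2 * (2 ^ M ∸ 1)
  size = begin
    length (deduplicate _≟V_ candidates)     ≤⟨ length-deduplicate _≟V_ candidates ⟩
    length candidates                       ≡⟨ trans (length-++ fibres) (cong₂ _+_
                                                 (length-cartesianProductWith _++_ code (allWords j))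
                                                 (length-map (_++ zeros) connectors)) ⟩
    length code * length (allWords j) + length connectors
                                            ≡⟨ cong₂ (λ a b → a * b + length connectors) size-code (length-allWords j) ⟩
    2 ^ M * 2 ^ j + length connectors       ≤⟨ +-mono-≤ (≤-reflexive (*-comm (2 ^ M) (2 ^ j))) connectors-bound ⟩
    2 ^ j * 2 ^ M + 2 * (2 ^ M ∸ 1)         ∎
    where
    open ≤-Reasoning
    connectors-bound : length connectors ≤ 2 * (2 ^ M ∸ 1)
    connectors-bound = ≤-trans (m+n≤o⇒m≤o∸n (length connectors) size-connectors)
      (≤-reflexive (trans (cong (λ z → 2 * z ∸ 2) size-code) (sym (*-distribˡ-∸ 2 (2 ^ M) 1))))

proposition5 : (k j : ℕ) → 1 ≤ k → 1 ≤ j → j ≤ 2 ^ k →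
    Σ (ConnectedDominatingSet ((2 ^ k ∸ 1) + j))
    (λ W → ConnectedDominatingSet.size W
    ≤ 2 ^ j * 2 ^ ((2 ^ k ∸ 1) ∸ k) + 2 * (2 ^ ((2 ^ k ∸ 1) ∸ k) ∸ 1))
proposition5 k j _ _ _ rewrite hammingLength-eq k | hammingDimension-eq k =
  CubeProduct.cds j (hammingCode k) , CubeProduct.size j (hammingCode k)
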